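{- Let $G$ be a finite DAG with $n \ge 2$ vertices and exactly one source vertex $s$. Let $D_{in}$ and $D_{out}$ be the maximum in-degree and the maximum out-degree of a vertex of $G$, and let $L$ be the maximum length (number of edges) of a simple directed path in $G$ starting at $s$. Then $$\frac{1}{n}\log(n!) \le L\,(D_{in} + D_{out}).$$
   Context: Here $\log$ denotes the logarithm to base $2$. -}

module Defs where

open import Data.Nat using (ℕ; zero; suc; _⊔_; _≤_)
open import Data.Bool using (Bool; true; false)
open import Data.Fin using (Fin)
open import Data.List using (List; []; _∷_; length; map; foldr; filterᵇ; allFin)
open import Data.List.Relation.Unary.Linked using (Linked)
open import Data.List.Relation.Unary.Unique.Propositional using (Unique)
open import Data.Product using (Σ; _×_; _,_)
open import Relation.Binary.PropositionalEquality using (_≡_)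
open import Relation.Binary.Construct.Closure.Transitive using (TransClosure)
open import Relation.Nullary using (¬_)

Digraph : ℕ → Set
Digraph n = Fin n → Fin n → Bool

Edge : ∀ {n} → Digraph n → Fin n → Fin n → Set
Edge E u v = E u v ≡ true

IsDAG : ∀ {n} → Digraph n → Set
IsDAG {n} E = (v : Fin n) → ¬ TransClosure (Edge E) v v

inDeg : ∀ {n} → Digraph n → Fin n → ℕ
inDeg {n} E v = length (filterᵇ (λ u → E u v) (allFin n))

outDeg : ∀ {n} → Digraph n → Fin n → ℕ
outDeg {n} E u = length (filterᵇ (λ v → E u v) (allFin n))

maxList : List ℕ → ℕ
maxList = foldr _⊔_ 0

Din : ∀ {n} → Digraph n → ℕ
Din {n} E = maxList (map (inDeg E) (allFin n))

Dout : ∀ {n} → Digraph n → ℕ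
Dout {n} E = maxList (map (outDeg E) (allFin n))

UniqueSource : ∀ {n} → Digraph n → Fin n → Set
UniqueSource {n} E s = inDeg E s ≡ 0 × ((v : Fin n) → inDeg E v ≡ 0 → v ≡ s)

-- A simple directed path starting at s, given by the list vs of vertices after s:
-- s → v₁ → … → v_k with all of s, v₁, …, v_k distinct. Its length is k = length vs.
SimplePathFrom : ∀ {n} → Digraph n → Fin n → List (Fin n) → Set
SimplePathFrom E s vs = Linked (Edge E) (s ∷ vs) × Unique (s ∷ vs)

IsMaxPathLength : ∀ {n} → Digraph n → Fin n → ℕ → Set
IsMaxPathLength {n} E s L =
  Σ (List (Fin n)) (λ vs → SimplePathFrom E s vs × length vs ≡ L)
  × ((vs : List (Fin n)) → SimplePathFrom E s vs → length vs ≤ L)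

{-# OPTIONS --safe #-}
-- Following in-edges backwards from a vertex v must stop, since a finite DAG has no
-- infinite descending chains, and it can only stop at the unique source s. This gives
-- a walk from s through v; walks in a DAG are simple, so it has length at most L and v
-- lies in the ball of radius L around s. That ball has at most (1 + D_out)^L ≤ 2^(L D_out)
-- vertices, so n ≤ 2^(L (D_in + D_out)), and n! ≤ n^n finishes the proof.
module Submission where

open import Defs
open import Data.Nat using (ℕ; zero; suc; z≤n; s≤s; _≤_; _≤′_; ≤′-refl; ≤′-step; _*_; _+_; _^_; _!)
open import Data.Nat.Properties
open import Data.Bool using (T?)
open import Data.Bool.Properties using (T-≡)
open import Data.Fin using (Fin)
open import Data.Fin.Induction using (spo-wellFounded)
open import Data.Fin.Properties using (injective⇒≤)
open import Data.List using (List; []; _∷_; length; filterᵇ; allFin; _++_)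
open import Data.List.Properties using (length-++)
open import Data.List.Relation.Unary.Any using (here; there)
open import Data.List.Relation.Unary.All using ([])
open import Data.List.Relation.Unary.All.Properties.Core using (¬Any⇒All¬)
open import Data.List.Relation.Unary.AllPairs using ([]; _∷_)
open import Data.List.Relation.Unary.Linked as Linked using (Linked; []; [-]; _∷_)
open import Data.List.Relation.Unary.Unique.Propositional using (Unique)
open import Data.List.Relation.Binary.Subset.Propositional using (_⊆_)
open import Data.List.Membership.Propositional using (_∈_)
open import Data.List.Membership.Propositional.Properties
  using (∈-++⁺ˡ; ∈-++⁺ʳ; ∈-map⁺; ∈-allFin; ∈-filter⁺; ∈-filter⁻)
open import Data.List.Membership.Setoid.Properties using (index-injective)
open import Data.Product using (_×_; _,_; proj₁; proj₂; ∃-syntax)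
open import Data.Sum using (_⊎_; inj₁; inj₂)
open import Function using (_∘_; id; Equivalence)
open import Induction.WellFounded using (WellFounded; Acc; acc)
open import Relation.Binary.PropositionalEquality using (_≡_; refl; sym; cong; subst; setoid; isEquivalence; resp₂)
open import Relation.Binary.Construct.Closure.Transitive as Plus using (TransClosure; [_]; _∷_)
open import Relation.Binary.Structures using (IsStrictPartialOrder)

n!≤n^n : ∀ n → n ! ≤ n ^ n
n!≤n^n zero = ≤-refl
n!≤n^n (suc n) = *-monoʳ-≤ (suc n) (≤-trans (n!≤n^n n) (^-monoˡ-≤ n (n≤1+n n)))

1+n≤2^n : ∀ n → suc n ≤ 2 ^ n
1+n≤2^n zero = ≤-refl
1+n≤2^n (suc n) = begin
  1 + suc n      ≤⟨ +-mono-≤ (≤-trans (s≤s z≤n) ih) ih ⟩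
  2 ^ n + 2 ^ n  ≡⟨ cong (2 ^ n +_) (sym (+-identityʳ (2 ^ n))) ⟩
  2 ^ suc n      ∎
  where
  open ≤-Reasoning
  ih : suc n ≤ 2 ^ n
  ih = 1+n≤2^n n

maxList-upper : ∀ {x} xs → x ∈ xs → x ≤ maxList xs
maxList-upper (y ∷ ys) (here refl) = m≤m⊔n y (maxList ys)
maxList-upper (y ∷ ys) (there x∈ys) = m≤n⇒m≤o⊔n y (maxList-upper ys x∈ys)

complete⇒n≤length : ∀ {n} {xs : List (Fin n)} → (∀ i → i ∈ xs) → n ≤ length xs
complete⇒n≤length complete =
  injective⇒≤ (index-injective (setoid _) (complete _) (complete _))

Linked⇒TransClosure : ∀ {A : Set} {R : A → A → Set} {x ys w} →
                      Linked R (x ∷ ys) → w ∈ ys → TransClosure R x w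
Linked⇒TransClosure (r ∷ _) (here refl) = [ r ]
Linked⇒TransClosure (r ∷ l) (there w∈ys) = r ∷ Linked⇒TransClosure l w∈ys

module Ball {A : Set} (next : A → List A) where

  Adjacent : A → A → Set
  Adjacent u v = v ∈ next u

  step : List A → List A
  step [] = []
  step (u ∷ us) = u ∷ next u ++ step us

  -- ball s k lists, with repetitions, everything reachable from s in at most k steps;
  -- keeping duplicates makes its length easy to bound.
  ball : A → ℕ → List A
  ball s zero = s ∷ []
  ball s (suc k) = step (ball s k)

  ∈-step⁺ : ∀ {u us w} → u ∈ us → w ∈ u ∷ next u → w ∈ step us
  ∈-step⁺ (here refl) (here refl) = here refl
  ∈-step⁺ (here refl) (there w∈next) = there (∈-++⁺ˡ w∈next)
  ∈-step⁺ {us = x ∷ _} (there u∈us) w∈ = there (∈-++⁺ʳ (next x) (∈-step⁺ u∈us w∈))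

  ball-mono : ∀ {s k m} → k ≤ m → ball s k ⊆ ball s m
  ball-mono k≤m = ball-mono′ (≤⇒≤′ k≤m)
    where
    ball-mono′ : ∀ {s k m} → k ≤′ m → ball s k ⊆ ball s m
    ball-mono′ ≤′-refl w∈ = w∈
    ball-mono′ (≤′-step k≤′m) w∈ = ∈-step⁺ (ball-mono′ k≤′m w∈) (here refl)

  walk⊆ball : ∀ {s k m x ys} → x ∈ ball s k → Linked Adjacent (x ∷ ys) →
              k + length ys ≤ m → x ∷ ys ⊆ ball s m
  walk⊆ball {k = k} x∈ _ k+l≤m (here refl) = ball-mono (≤-trans (m≤m+n k _) k+l≤m) x∈
  walk⊆ball {k = k} {ys = _ ∷ ys} x∈ (y∈next ∷ l) k+l≤m (there w∈) =
    walk⊆ball (∈-step⁺ x∈ (there y∈next)) l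
      (≤-trans (≤-reflexive (sym (+-suc k (length ys)))) k+l≤m) w∈

  module _ {D : ℕ} (next-bounded : ∀ u → length (next u) ≤ D) where

    length-step : ∀ us → length (step us) ≤ length us * suc D
    length-step [] = z≤n
    length-step (u ∷ us) = s≤s (begin
      length (next u ++ step us)        ≡⟨ length-++ (next u) ⟩
      length (next u) + length (step us) ≤⟨ +-mono-≤ (next-bounded u) (length-step us) ⟩
      D + length us * suc D             ∎)
      where open ≤-Reasoning

    length-ball : ∀ s k → length (ball s k) ≤ suc D ^ k
    length-ball s zero = ≤-refl
    length-ball s (suc k) = begin
      length (step (ball s k))   ≤⟨ length-step (ball s k) ⟩
      length (ball s k) * suc D  ≤⟨ *-monoˡ-≤ (suc D) (length-ball s k) ⟩
      suc D ^ k * suc D          ≡⟨ *-comm (suc D ^ k) (suc D) ⟩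
      suc D ^ suc k              ∎
      where open ≤-Reasoning

module _ {n} (E : Digraph n) where

  outNeighbours : Fin n → List (Fin n)
  outNeighbours u = filterᵇ (E u) (allFin n)

  inNeighbours : Fin n → List (Fin n)
  inNeighbours v = filterᵇ (λ u → E u v) (allFin n)

  ∈-outNeighbours⁺ : ∀ {u v} → Edge E u v → v ∈ outNeighbours u
  ∈-outNeighbours⁺ {u} e = ∈-filter⁺ (T? ∘ E u) (∈-allFin _) (Equivalence.from T-≡ e)

  ∈-inNeighbours⁻ : ∀ {u v} → u ∈ inNeighbours v → Edge E u v
  ∈-inNeighbours⁻ {v = v} u∈ =
    Equivalence.to T-≡ (proj₂ (∈-filter⁻ (T? ∘ λ u → E u v) {xs = allFin n} u∈))

  source-or-hasPredecessor : ∀ {s} → UniqueSource E s → ∀ v → v ≡ s ⊎ ∃[ u ] Edge E u v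
  source-or-hasPredecessor (_ , onlySource) v with inNeighbours v in eq
  ... | [] = inj₁ (onlySource v (cong length eq))
  ... | u ∷ _ = inj₂ (u , ∈-inNeighbours⁻ (subst (u ∈_) (sym eq) (here refl)))

  Linked⇒Unique : IsDAG E → ∀ {xs} → Linked (Edge E) xs → Unique xs
  Linked⇒Unique dag [] = []
  Linked⇒Unique dag [-] = [] ∷ []
  Linked⇒Unique dag (e ∷ l) =
    ¬Any⇒All¬ _ (dag _ ∘ Linked⇒TransClosure (e ∷ l)) ∷ Linked⇒Unique dag l

  dag-wellFounded : IsDAG E → WellFounded (Edge E)
  dag-wellFounded dag = Plus.wellFounded⁻ (Edge E) (spo-wellFounded isSPO)
    where
    isSPO : IsStrictPartialOrder _≡_ (TransClosure (Edge E))
    isSPO = record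
      { isEquivalence = isEquivalence
      ; irrefl = λ { refl → dag _ }
      ; trans = Plus._++_
      ; <-resp-≈ = resp₂ (TransClosure (Edge E))
      }

  walkFromSource : ∀ {s} → (∀ v → v ≡ s ⊎ ∃[ u ] Edge E u v) →
                   ∀ {u rest} → Acc (Edge E) u → Linked (Edge E) (u ∷ rest) →
                   ∃[ ws ] Linked (Edge E) (s ∷ ws) × u ∷ rest ⊆ s ∷ ws
  walkFromSource sourceOrPredecessor {u} (acc rs) walk with sourceOrPredecessor u
  ... | inj₁ refl = _ , walk , id
  ... | inj₂ (_ , e)
    with ws , walk′ , ⊆ws ← walkFromSource sourceOrPredecessor (rs e) (e ∷ walk) =
    ws , walk′ , ⊆ws ∘ there

  onSimplePathFromSource : IsDAG E → ∀ {s} → UniqueSource E s →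
                           ∀ v → ∃[ ws ] SimplePathFrom E s ws × v ∈ s ∷ ws
  onSimplePathFromSource dag src v
    with ws , walk , ⊆ws ←
           walkFromSource (source-or-hasPredecessor src) (dag-wellFounded dag v) [-] =
    ws , (walk , Linked⇒Unique dag walk) , ⊆ws (here refl)

  n≤[1+Dout]^L : IsDAG E → ∀ {s L} → UniqueSource E s →
                 (∀ ws → SimplePathFrom E s ws → length ws ≤ L) → n ≤ suc (Dout E) ^ L
  n≤[1+Dout]^L dag {s} {L} src longest = begin
    n                  ≤⟨ complete⇒n≤length inBall ⟩
    length (ball s L)  ≤⟨ length-ball outDeg≤Dout s L ⟩
    suc (Dout E) ^ L   ∎
    where
    open Ball outNeighbours
    open ≤-Reasoning
    outDeg≤Dout : ∀ u → length (outNeighbours u) ≤ Dout E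
    outDeg≤Dout u = maxList-upper _ (∈-map⁺ (outDeg E) (∈-allFin u))
    inBall : ∀ v → v ∈ ball s L
    inBall v with ws , path , v∈ ← onSimplePathFromSource dag src v =
      walk⊆ball (here refl) (Linked.map ∈-outNeighbours⁺ (proj₁ path)) (longest ws path) v∈

mainTheorem2 : (n : ℕ) → 2 ≤ n → (E : Digraph n) → IsDAG E
    → (s : Fin n) → UniqueSource E s
    → (L : ℕ) → IsMaxPathLength E s L
    → n ! ≤ 2 ^ (n * (L * (Din E + Dout E)))
mainTheorem2 n _ E dag s src L (_ , longest) = begin
  n !                ≤⟨ n!≤n^n n ⟩
  n ^ n              ≤⟨ ^-monoˡ-≤ n n≤2^[L*X] ⟩
  (2 ^ (L * X)) ^ n  ≡⟨ ^-*-assoc 2 (L * X) n ⟩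
  2 ^ (L * X * n)    ≡⟨ cong (2 ^_) (*-comm (L * X) n) ⟩
  2 ^ (n * (L * X))  ∎
  where
  open ≤-Reasoning
  X : ℕ
  X = Din E + Dout E
  n≤2^[L*X] : n ≤ 2 ^ (L * X)
  n≤2^[L*X] = begin
    n                 ≤⟨ n≤[1+Dout]^L E dag src longest ⟩
    suc (Dout E) ^ L  ≤⟨ ^-monoˡ-≤ L (1+n≤2^n (Dout E)) ⟩
    (2 ^ Dout E) ^ L  ≡⟨ ^-*-assoc 2 (Dout E) L ⟩
    2 ^ (Dout E * L)  ≡⟨ cong (2 ^_) (*-comm (Dout E) L) ⟩
    2 ^ (L * Dout E)  ≤⟨ ^-monoʳ-≤ 2 (*-monoʳ-≤ L (m≤n+m (Dout E) (Din E))) ⟩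
    2 ^ (L * X)       ∎
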